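{- Let $G$ and $H$ be graphs such that there exist labeled contraction sequences $S_1$ on $G$ and $S_2$ on $H$ with $|S_1|+|S_2|\le k$ and $G/S_1=H/S_2$. Then $tw(G\cup H)\le \min(tw(G),tw(H))+k$, where $G\cup H$ is the graph with vertex set $V(G)\cup V(H)$ and edge set $E(G)\cup E(H)$.
   Context: Graphs are finite, simple and undirected; vertices are uniquely labeled and graphs are equal iff they have the same vertex and edge sets. For an edge $uv$, the labeled contraction $(u,v)$ yields $G/(u,v)$: add an edge between $u$ and every vertex of $N_G(v)\setminus N_G[u]$, then delete $v$. For a labeled contraction sequence $S$ (contractions applied in order, each to an edge of the current graph), $G/S$ is the resulting graph and $|S|$ its length. $tw$ denotes treewidth. -}

module Defs where

open import Data.Nat using (ℕ; zero; suc; _≤_; _<_; _≟_)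
open import Data.Fin using (Fin; toℕ)
open import Data.List using (List; []; _∷_; filter; length; foldl; _++_)
open import Data.List.Membership.Propositional using (_∈_)
open import Data.List.Relation.Unary.Unique.Propositional using (Unique)
open import Data.Product using (Σ; ∃; _×_; _,_)
open import Data.Sum using (_⊎_)
open import Relation.Binary.PropositionalEquality using (_≡_; _≢_)
open import Relation.Nullary using (¬_; ¬?)
open import Function.Bundles using (_⇔_)

-- A (raw) labeled graph: finite list of vertex labels (only membership
-- matters) and an edge relation on labels.
record Graph : Set₁ where
  constructor mkGraph
  field
    V : List ℕ
    E : ℕ → ℕ → Set
open Graph public

record IsSimple (G : Graph) : Set where
  field
    edge-in-V : ∀ x y → E G x y → (x ∈ V G) × (y ∈ V G)
    irrefl    : ∀ x → ¬ E G x x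
    sym       : ∀ x y → E G x y → E G y x
open IsSimple public

_≐_ : Graph → Graph → Set
G ≐ H = (∀ x → (x ∈ V G) ⇔ (x ∈ V H)) × (∀ x y → E G x y ⇔ E H x y)

_∪G_ : Graph → Graph → Graph
G ∪G H = mkGraph (V G ++ V H) (λ x y → E G x y ⊎ E H x y)

-- labeled contraction (u , v): connect u to every vertex of N(v) \ N[u], delete v
contract : Graph → ℕ × ℕ → Graph
contract G (u , v) = mkGraph (filter (λ x → ¬? (x ≟ v)) (V G)) E'
  where
  E' : ℕ → ℕ → Set
  E' x y = (x ≢ v) × (y ≢ v) ×
           (E G x y
           ⊎ ((x ≡ u) × E G v y × ¬ E G u y × (y ≢ u))
           ⊎ ((y ≡ u) × E G v x × ¬ E G u x × (x ≢ u)))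

_/S_ : Graph → List (ℕ × ℕ) → Graph
G /S S = foldl contract G S

data IsContrSeq : Graph → List (ℕ × ℕ) → Set₁ where
  done : ∀ {G} → IsContrSeq G []
  step : ∀ {G u v S} → u ∈ V G → v ∈ V G → E G u v →
         IsContrSeq (contract G (u , v)) S → IsContrSeq G ((u , v) ∷ S)

-- Trees on node set Fin (suc m), given by a parent array: node i > 0 has a
-- parent p i with toℕ (p i) < toℕ i (node 0 is the root).
record Tree : Set where
  field
    m      : ℕ
    parent : Fin (suc m) → Fin (suc m)
    parent< : ∀ i → 0 < toℕ i → toℕ (parent i) < toℕ i
open Tree public

TAdj : (T : Tree) → Fin (suc (m T)) → Fin (suc (m T)) → Set
TAdj T i j = (0 < toℕ i × parent T i ≡ j) ⊎ (0 < toℕ j × parent T j ≡ i)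

data WalkIn (T : Tree) (P : Fin (suc (m T)) → Set) :
     Fin (suc (m T)) → Fin (suc (m T)) → Set where
  here : ∀ {i} → P i → WalkIn T P i i
  next : ∀ {i j k} → P i → TAdj T i j → WalkIn T P j k → WalkIn T P i k

record TreeDecomp (G : Graph) (w : ℕ) : Set where
  field
    tree : Tree
    bag  : Fin (suc (m tree)) → List ℕ
    bag-unique : ∀ i → Unique (bag i)
    bag-in-V   : ∀ i x → x ∈ bag i → x ∈ V G
    cover-V    : ∀ x → x ∈ V G → ∃ λ i → x ∈ bag i
    cover-E    : ∀ x y → E G x y → ∃ λ i → (x ∈ bag i) × (y ∈ bag i)
    connected  : ∀ x i j → x ∈ bag i → x ∈ bag j →
                 WalkIn tree (λ t → x ∈ bag t) i j
    width≤     : ∀ i → length (bag i) ≤ suc w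

IsTreewidth : Graph → ℕ → Set
IsTreewidth G t = TreeDecomp G t × (∀ w → TreeDecomp G w → t ≤ w)

-- Contracting an edge uv of G maps a tree decomposition of G onto one of G/(u,v)
-- of no larger width: replace v by u in every bag; the bags containing u stay
-- connected because some bag holds both u and v.  So S₁ turns a decomposition of
-- G of width tw(G) into one of G/S₁ = H/S₂ of the same width.
-- Every vertex of G ∪ H and every edge between survivors lives in G/S₁, and the
-- remaining vertices are the at most k deleted ones, which we add to every bag.
module Submission where

open import Defs
open import Data.Nat using (ℕ; suc; _≤_; _+_; _⊓_; _≟_; z≤n; s≤s)
open import Data.Nat.Properties using (≤-refl; ≤-trans; ≤-reflexive; ≤-pred; +-mono-≤; +-comm; +-distribʳ-⊓; ⊓-glb)
open import Data.Fin using (Fin; toℕ) renaming (zero to fzero; suc to fsuc)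
open import Data.List using (List; []; _∷_; length; map; _++_; deduplicate)
open import Data.List.Properties using (length-map; length-++; length-deduplicate)
open import Data.List.Membership.Propositional using (_∈_; _∉_)
open import Data.List.Membership.Propositional.Properties
  using (∈-filter⁺; ∈-filter⁻; ∈-map⁺; ∈-map⁻; ∈-++⁺ˡ; ∈-++⁺ʳ; ∈-++⁻; ∈-deduplicate⁺; ∈-deduplicate⁻)
open import Data.List.Membership.DecPropositional _≟_ using (_∈?_)
open import Data.List.Relation.Unary.Unique.DecPropositional.Properties _≟_ using (deduplicate-!)
open import Data.List.Relation.Unary.Any using (here; there)
open import Data.List.Relation.Unary.Any.Properties using (++-comm)
open import Data.Product using (∃; _×_; _,_; proj₁; proj₂)
open import Data.Sum using (_⊎_; inj₁; inj₂) renaming (swap to swap⊎)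
open import Data.Empty using (⊥-elim)
open import Relation.Binary.PropositionalEquality using (_≡_; _≢_; refl; cong₂; subst; trans) renaming (sym to ≡-sym)
open import Relation.Nullary using (¬_; ¬?; yes; no)
open import Function.Bundles using (Equivalence; mk⇔)

TAdj-sym : ∀ {T i j} → TAdj T i j → TAdj T j i
TAdj-sym (inj₁ p) = inj₂ p
TAdj-sym (inj₂ p) = inj₁ p

walk-head : ∀ {T P i j} → WalkIn T P i j → P i
walk-head (here p)     = p
walk-head (next p _ _) = p

walk-++ : ∀ {T P i j k} → WalkIn T P i j → WalkIn T P j k → WalkIn T P i k
walk-++ (here _)     w′ = w′
walk-++ (next p a w) w′ = next p a (walk-++ w w′)

walk-reverse : ∀ {T P i j} → WalkIn T P i j → WalkIn T P j i
walk-reverse (here p) = here p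
walk-reverse {T} (next p a w) =
  walk-++ (walk-reverse w) (next (walk-head {T} w) (TAdj-sym {T} a) (here p))

walk-map : ∀ {T P Q i j} → (∀ t → P t → Q t) → WalkIn T P i j → WalkIn T Q i j
walk-map f (here p)     = here (f _ p)
walk-map f (next p a w) = next (f _ p) a (walk-map f w)

-- n is fuel: toℕ strictly decreases along parents.
walk-to-root : (T : Tree) {P : Fin (suc (m T)) → Set} → (∀ t → P t) →
               ∀ n i → toℕ i ≤ n → WalkIn T P i fzero
walk-to-root T all n       fzero    _          = here (all fzero)
walk-to-root T all (suc n) (fsuc i) (s≤s i≤n) =
  next (all _) (inj₁ (s≤s z≤n , refl))
       (walk-to-root T all n (parent T (fsuc i))
          (≤-trans (≤-pred (parent< T (fsuc i) (s≤s z≤n))) i≤n))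

walk-everywhere : (T : Tree) {P : Fin (suc (m T)) → Set} → (∀ t → P t) →
                  ∀ i j → WalkIn T P i j
walk-everywhere T all i j =
  walk-++ (walk-to-root T all (toℕ i) i ≤-refl)
          (walk-reverse (walk-to-root T all (toℕ j) j ≤-refl))

-- Mapping bags through a contraction creates repeated entries; they are
-- removed only once, at the end, by deduplication.
record WeakTreeDecomp (G : Graph) (w : ℕ) : Set where
  field
    tree      : Tree
    bag       : Fin (suc (m tree)) → List ℕ
    bag-in-V  : ∀ i x → x ∈ bag i → x ∈ V G
    cover-V   : ∀ x → x ∈ V G → ∃ λ i → x ∈ bag i
    cover-E   : ∀ x y → E G x y → ∃ λ i → (x ∈ bag i) × (y ∈ bag i)
    connected : ∀ x i j → x ∈ bag i → x ∈ bag j →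
                WalkIn tree (λ t → x ∈ bag t) i j
    width≤    : ∀ i → length (bag i) ≤ suc w

TreeDecomp⇒Weak : ∀ {G w} → TreeDecomp G w → WeakTreeDecomp G w
TreeDecomp⇒Weak d = record
  { tree = tree ; bag = bag ; bag-in-V = bag-in-V ; cover-V = cover-V
  ; cover-E = cover-E ; connected = connected ; width≤ = width≤ }
  where open TreeDecomp d

Weak⇒TreeDecomp : ∀ {G w} → WeakTreeDecomp G w → TreeDecomp G w
Weak⇒TreeDecomp d = record
  { tree       = tree
  ; bag        = bag′
  ; bag-unique = λ i → deduplicate-! (bag i)
  ; bag-in-V   = λ i x p → bag-in-V i x (from i p)
  ; cover-V    = λ x p → let i , q = cover-V x p in i , to q
  ; cover-E    = λ x y e → let i , p , q = cover-E x y e in i , to p , to q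
  ; connected  = λ x i j p q → walk-map (λ _ → to) (connected x i j (from i p) (from j q))
  ; width≤     = λ i → ≤-trans (length-deduplicate _≟_ (bag i)) (width≤ i)
  }
  where
  open WeakTreeDecomp d
  bag′ : Fin (suc (m tree)) → List ℕ
  bag′ i = deduplicate _≟_ (bag i)
  to : ∀ {x i} → x ∈ bag i → x ∈ bag′ i
  to = ∈-deduplicate⁺ _≟_
  from : ∀ {x} i → x ∈ bag′ i → x ∈ bag i
  from i = ∈-deduplicate⁻ _≟_ (bag i)

merge : ℕ → ℕ → ℕ → ℕ
merge u v x with x ≟ v
... | yes _ = u
... | no  _ = x

merge-∈⁺ : ∀ {u v x B} → x ≢ v → x ∈ B → x ∈ map (merge u v) B
merge-∈⁺ {u} {v} {x} x≢v x∈B with ∈-map⁺ (merge u v) x∈B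
... | p with x ≟ v
...   | yes x≡v = ⊥-elim (x≢v x≡v)
...   | no  _   = p

merge-∈⁺-v : ∀ {u v B} → v ∈ B → u ∈ map (merge u v) B
merge-∈⁺-v {u} {v} v∈B with ∈-map⁺ (merge u v) v∈B
... | p with v ≟ v
...   | yes _   = p
...   | no  v≢v = ⊥-elim (v≢v refl)

merge-∈⁻ : ∀ {u v x B} → x ∈ map (merge u v) B → (x ≡ u × v ∈ B) ⊎ (x ≢ v × x ∈ B)
merge-∈⁻ {u} {v} p with ∈-map⁻ (merge u v) p
... | y , y∈B , refl with y ≟ v
...   | yes refl = inj₁ (refl , y∈B)
...   | no  y≢v  = inj₂ (y≢v , y∈B)

merge-∉v : ∀ {u v x B} → u ≢ v → x ∈ map (merge u v) B → x ≢ v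
merge-∉v u≢v p with merge-∈⁻ p
... | inj₁ (refl , _) = u≢v
... | inj₂ (x≢v , _)  = x≢v

contract-irrefl : ∀ G u v → (∀ x → ¬ E G x x) → ∀ x → ¬ E (contract G (u , v)) x x
contract-irrefl G u v irr x (_ , _ , inj₁ e)                        = irr x e
contract-irrefl G u v irr x (_ , _ , inj₂ (inj₁ (x≡u , _ , _ , x≢u))) = x≢u x≡u
contract-irrefl G u v irr x (_ , _ , inj₂ (inj₂ (x≡u , _ , _ , x≢u))) = x≢u x≡u

contract-decomp : ∀ {G u v w} → E G u v → u ∈ V G → u ≢ v →
                  WeakTreeDecomp G w → WeakTreeDecomp (contract G (u , v)) w
contract-decomp {G} {u} {v} {w} uv u∈G u≢v d = record
  { tree      = tree
  ; bag       = bag′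
  ; bag-in-V  = bag′-in-V
  ; cover-V   = λ x p → let x∈G , x≢v = ∈-filter⁻ (λ y → ¬? (y ≟ v)) p
                            i , q     = cover-V x x∈G
                        in i , merge-∈⁺ x≢v q
  ; cover-E   = cover-E′
  ; connected = connected′
  ; width≤    = λ i → subst (_≤ suc w) (≡-sym (length-map (merge u v) (bag i))) (width≤ i)
  }
  where
  open WeakTreeDecomp d
  bag′ : Fin (suc (m tree)) → List ℕ
  bag′ i = map (merge u v) (bag i)

  bag′-in-V : ∀ i x → x ∈ bag′ i → x ∈ V (contract G (u , v))
  bag′-in-V i x p = ∈-filter⁺ (λ y → ¬? (y ≟ v)) x∈G (merge-∉v u≢v p)
    where
    x∈G : x ∈ V G
    x∈G with merge-∈⁻ p
    ... | inj₁ (refl , _) = u∈G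
    ... | inj₂ (_ , x∈B) = bag-in-V i x x∈B

  cover-E′ : ∀ x y → E (contract G (u , v)) x y → ∃ λ i → (x ∈ bag′ i) × (y ∈ bag′ i)
  cover-E′ x y (x≢v , y≢v , inj₁ xy) =
    let i , p , q = cover-E x y xy in i , merge-∈⁺ x≢v p , merge-∈⁺ y≢v q
  cover-E′ x y (x≢v , y≢v , inj₂ (inj₁ (refl , vy , _))) =
    let i , p , q = cover-E v y vy in i , merge-∈⁺-v p , merge-∈⁺ y≢v q
  cover-E′ x y (x≢v , y≢v , inj₂ (inj₂ (refl , vx , _))) =
    let i , p , q = cover-E v x vx in i , merge-∈⁺ x≢v q , merge-∈⁺-v p

  to-uv-bag : ∀ i → u ∈ bag′ i → WalkIn tree (λ t → u ∈ bag′ t) i (proj₁ (cover-E u v uv))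
  to-uv-bag i p with cover-E u v uv | merge-∈⁻ p
  ... | k , _ , v∈k | inj₁ (_ , v∈i) = walk-map (λ _ → merge-∈⁺-v) (connected v i k v∈i v∈k)
  ... | k , u∈k , _ | inj₂ (_ , u∈i) = walk-map (λ _ → merge-∈⁺ u≢v) (connected u i k u∈i u∈k)

  connected′ : ∀ x i j → x ∈ bag′ i → x ∈ bag′ j → WalkIn tree (λ t → x ∈ bag′ t) i j
  connected′ x i j p q with x ≟ u
  ... | yes refl = walk-++ (to-uv-bag i p) (walk-reverse (to-uv-bag j q))
  ... | no  x≢u  = walk-map (λ _ → merge-∈⁺ (merge-∉v u≢v p)) (connected x i j (unmerge p) (unmerge q))
    where
    unmerge : ∀ {t} → x ∈ bag′ t → x ∈ bag t
    unmerge r with merge-∈⁻ r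
    ... | inj₁ (x≡u , _) = ⊥-elim (x≢u x≡u)
    ... | inj₂ (_ , x∈B) = x∈B

/S-decomp : ∀ {G S w} → IsContrSeq G S → (∀ x → ¬ E G x x) →
            WeakTreeDecomp G w → WeakTreeDecomp (G /S S) w
/S-decomp done irr d = d
/S-decomp {G} (step {u = u} {v = v} u∈G _ uv S) irr d =
  /S-decomp S (contract-irrefl G u v irr) (contract-decomp uv u∈G u≢v d)
  where
  u≢v : u ≢ v
  u≢v refl = irr u uv

deleted : List (ℕ × ℕ) → List ℕ
deleted = map proj₂

/S-V⊆ : ∀ G S {x} → x ∈ V (G /S S) → x ∈ V G
/S-V⊆ G []            p = p
/S-V⊆ G ((u , v) ∷ S) p = proj₁ (∈-filter⁻ (λ y → ¬? (y ≟ v)) (/S-V⊆ (contract G (u , v)) S p))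

deleted⊆V : ∀ {G S x} → IsContrSeq G S → x ∈ deleted S → x ∈ V G
deleted⊆V (step _ v∈G _ _) (here refl) = v∈G
deleted⊆V (step {v = v} _ _ _ S) (there p) = proj₁ (∈-filter⁻ (λ y → ¬? (y ≟ v)) (deleted⊆V S p))

survivor-∈V : ∀ G S {x} → x ∈ V G → x ∉ deleted S → x ∈ V (G /S S)
survivor-∈V G []            x∈G _ = x∈G
survivor-∈V G ((u , v) ∷ S) x∈G x∉D =
  survivor-∈V (contract G (u , v)) S
    (∈-filter⁺ (λ y → ¬? (y ≟ v)) x∈G (λ x≡v → x∉D (here x≡v))) (λ p → x∉D (there p))

survivor-E : ∀ G S {x y} → E G x y → x ∉ deleted S → y ∉ deleted S → E (G /S S) x y
survivor-E G []            xy _ _ = xy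
survivor-E G ((u , v) ∷ S) xy x∉D y∉D =
  survivor-E (contract G (u , v)) S ((λ x≡v → x∉D (here x≡v)) , (λ y≡v → y∉D (here y≡v)) , inj₁ xy)
    (λ p → x∉D (there p)) (λ p → y∉D (there p))

add-to-every-bag : ∀ {K K′ w d} (D : List ℕ) → length D ≤ d →
  (∀ x y → E K x y → x ∈ V K × y ∈ V K) →
  (∀ x → x ∈ V K′ → x ∈ V K) → (∀ x → x ∈ D → x ∈ V K) →
  (∀ x → x ∈ V K → x ∉ D → x ∈ V K′) →
  (∀ x y → E K x y → x ∉ D → y ∉ D → E K′ x y) →
  WeakTreeDecomp K′ w → WeakTreeDecomp K (w + d)
add-to-every-bag {K} {K′} D |D|≤d K-edges K′⊆K D⊆K K-D⊆K′ E-D⊆K′ d = record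
  { tree      = tree
  ; bag       = bag′
  ; bag-in-V  = bag′-in-V
  ; cover-V   = cover-V′
  ; cover-E   = cover-E′
  ; connected = connected′
  ; width≤    = λ i → ≤-trans (≤-reflexive (length-++ (bag i))) (+-mono-≤ (width≤ i) |D|≤d)
  }
  where
  open WeakTreeDecomp d
  bag′ : Fin (suc (m tree)) → List ℕ
  bag′ i = bag i ++ D

  in-every-bag : ∀ {x} → x ∈ D → ∀ i → x ∈ bag′ i
  in-every-bag p i = ∈-++⁺ʳ (bag i) p

  bag′-in-V : ∀ i x → x ∈ bag′ i → x ∈ V K
  bag′-in-V i x p with ∈-++⁻ (bag i) p
  ... | inj₁ q = K′⊆K x (bag-in-V i x q)
  ... | inj₂ q = D⊆K x q

  cover-V′ : ∀ x → x ∈ V K → ∃ λ i → x ∈ bag′ i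
  cover-V′ x x∈K with x ∈? D
  ... | yes x∈D = fzero , in-every-bag x∈D fzero
  ... | no  x∉D = let i , p = cover-V x (K-D⊆K′ x x∈K x∉D) in i , ∈-++⁺ˡ p

  cover-E′ : ∀ x y → E K x y → ∃ λ i → (x ∈ bag′ i) × (y ∈ bag′ i)
  cover-E′ x y xy with x ∈? D | y ∈? D
  ... | yes x∈D | _       = let i , p = cover-V′ y (proj₂ (K-edges x y xy)) in i , in-every-bag x∈D i , p
  ... | no  _   | yes y∈D = let i , p = cover-V′ x (proj₁ (K-edges x y xy)) in i , p , in-every-bag y∈D i
  ... | no  x∉D | no  y∉D = let i , p , q = cover-E x y (E-D⊆K′ x y xy x∉D y∉D) in i , ∈-++⁺ˡ p , ∈-++⁺ˡ q

  connected′ : ∀ x i j → x ∈ bag′ i → x ∈ bag′ j → WalkIn tree (λ t → x ∈ bag′ t) i j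
  connected′ x i j p q with x ∈? D
  ... | yes x∈D = walk-everywhere tree (in-every-bag x∈D) i j
  ... | no  x∉D = walk-map (λ _ → ∈-++⁺ˡ) (connected x i j (drop-D p) (drop-D q))
    where
    drop-D : ∀ {t} → x ∈ bag′ t → x ∈ bag t
    drop-D {t} r with ∈-++⁻ (bag t) r
    ... | inj₁ r′  = r′
    ... | inj₂ x∈D = ⊥-elim (x∉D x∈D)

_⊆ᴳ_ : Graph → Graph → Set
G ⊆ᴳ H = (∀ x → x ∈ V G → x ∈ V H) × (∀ x y → E G x y → E H x y)

≐⇒⊆ᴳ : ∀ {G H} → G ≐ H → G ⊆ᴳ H
≐⇒⊆ᴳ (V≡ , E≡) = (λ x → Equivalence.to (V≡ x)) , (λ x y → Equivalence.to (E≡ x y))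

≐⇒⊇ᴳ : ∀ {G H} → G ≐ H → H ⊆ᴳ G
≐⇒⊇ᴳ (V≡ , E≡) = (λ x → Equivalence.from (V≡ x)) , (λ x y → Equivalence.from (E≡ x y))

∪G-comm : ∀ G H → (G ∪G H) ≐ (H ∪G G)
∪G-comm G H = (λ x → mk⇔ (++-comm (V G) (V H)) (++-comm (V H) (V G)))
            , (λ x y → mk⇔ swap⊎ swap⊎)

TreeDecomp-resp-≐ : ∀ {G H w} → G ≐ H → TreeDecomp G w → TreeDecomp H w
TreeDecomp-resp-≐ G≐H d = record
  { tree = tree ; bag = bag ; bag-unique = bag-unique
  ; bag-in-V  = λ i x p → proj₁ (≐⇒⊆ᴳ G≐H) x (bag-in-V i x p)
  ; cover-V   = λ x p → cover-V x (proj₁ (≐⇒⊇ᴳ G≐H) x p)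
  ; cover-E   = λ x y e → cover-E x y (proj₂ (≐⇒⊇ᴳ G≐H) x y e)
  ; connected = connected ; width≤ = width≤ }
  where open TreeDecomp d

∪G-edge-in-V : ∀ {G H} → IsSimple G → IsSimple H →
               ∀ x y → E (G ∪G H) x y → x ∈ V (G ∪G H) × y ∈ V (G ∪G H)
∪G-edge-in-V {G} sG sH x y (inj₁ xy) = let p , q = edge-in-V sG x y xy in ∈-++⁺ˡ p , ∈-++⁺ˡ q
∪G-edge-in-V {G} sG sH x y (inj₂ xy) = let p , q = edge-in-V sH x y xy in ∈-++⁺ʳ (V G) p , ∈-++⁺ʳ (V G) q

TreeDecomp-∪ : ∀ {G H S₁ S₂ w k} → IsSimple G → IsSimple H →
               IsContrSeq G S₁ → IsContrSeq H S₂ → length S₁ + length S₂ ≤ k →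
               (H /S S₂) ⊆ᴳ (G /S S₁) →
               TreeDecomp G w → TreeDecomp (G ∪G H) (w + k)
TreeDecomp-∪ {G} {H} {S₁} {S₂} {k = k} sG sH c₁ c₂ |S|≤k (V⊆ , E⊆) d =
  Weak⇒TreeDecomp
    (add-to-every-bag D |D|≤k (∪G-edge-in-V sG sH)
       (λ x p → ∈-++⁺ˡ (/S-V⊆ G S₁ p)) D⊆V survivor∈G/S₁ survivor-edge
       (/S-decomp c₁ (irrefl sG) (TreeDecomp⇒Weak d)))
  where
  D : List ℕ
  D = deleted S₁ ++ deleted S₂

  |D|≤k : length D ≤ k
  |D|≤k = ≤-trans (≤-reflexive (trans (length-++ (deleted S₁))
                     (cong₂ _+_ (length-map proj₂ S₁) (length-map proj₂ S₂)))) |S|≤k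

  ∉D₁ : ∀ {x} → x ∉ D → x ∉ deleted S₁
  ∉D₁ x∉D p = x∉D (∈-++⁺ˡ p)

  ∉D₂ : ∀ {x} → x ∉ D → x ∉ deleted S₂
  ∉D₂ x∉D p = x∉D (∈-++⁺ʳ (deleted S₁) p)

  D⊆V : ∀ x → x ∈ D → x ∈ V (G ∪G H)
  D⊆V x p with ∈-++⁻ (deleted S₁) p
  ... | inj₁ q = ∈-++⁺ˡ (deleted⊆V c₁ q)
  ... | inj₂ q = ∈-++⁺ʳ (V G) (deleted⊆V c₂ q)

  survivor∈G/S₁ : ∀ x → x ∈ V (G ∪G H) → x ∉ D → x ∈ V (G /S S₁)
  survivor∈G/S₁ x p x∉D with ∈-++⁻ (V G) p
  ... | inj₁ x∈G = survivor-∈V G S₁ x∈G (∉D₁ x∉D)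
  ... | inj₂ x∈H = V⊆ x (survivor-∈V H S₂ x∈H (∉D₂ x∉D))

  survivor-edge : ∀ x y → E (G ∪G H) x y → x ∉ D → y ∉ D → E (G /S S₁) x y
  survivor-edge x y (inj₁ xy) x∉D y∉D = survivor-E G S₁ xy (∉D₁ x∉D) (∉D₁ y∉D)
  survivor-edge x y (inj₂ xy) x∉D y∉D = E⊆ x y (survivor-E H S₂ xy (∉D₂ x∉D) (∉D₂ y∉D))

lemma14 : (G H : Graph) → IsSimple G → IsSimple H →
    (k : ℕ) (S₁ S₂ : List (ℕ × ℕ)) →
    IsContrSeq G S₁ → IsContrSeq H S₂ →
    length S₁ + length S₂ ≤ k →
    (G /S S₁) ≐ (H /S S₂) →
    (tG tH t : ℕ) → IsTreewidth G tG → IsTreewidth H tH →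
    IsTreewidth (G ∪G H) t →
    t ≤ (tG ⊓ tH) + k
lemma14 G H sG sH k S₁ S₂ c₁ c₂ |S|≤k G/S₁≐H/S₂ tG tH t (dG , _) (dH , _) (_ , tw-minimal) =
  subst (t ≤_) (≡-sym (+-distribʳ-⊓ k tG tH)) (⊓-glb via-G via-H)
  where
  via-G : t ≤ tG + k
  via-G = tw-minimal _ (TreeDecomp-∪ sG sH c₁ c₂ |S|≤k (≐⇒⊇ᴳ G/S₁≐H/S₂) dG)

  via-H : t ≤ tH + k
  via-H = tw-minimal _ (TreeDecomp-resp-≐ (∪G-comm H G)
            (TreeDecomp-∪ sH sG c₂ c₁ (subst (_≤ k) (+-comm (length S₁) (length S₂)) |S|≤k)
               (≐⇒⊆ᴳ G/S₁≐H/S₂) dH))
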